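{- Let $2<c<4$ be a real number. There exists $k(c)$ such that for all integers $n,k$ with $n=ck$ and $k>k(c)$, there is an intersecting family $\mathcal{F}\subset\binom{[n]}{k}$ with $$|\mathcal{D}(\mathcal{F})| > \sum_{0\le \ell<k}\binom{n-1}{\ell}.$$
   Context: $[n]=\{1,\dots,n\}$ and $\binom{[n]}{k}$ is the family of all $k$-element subsets of $[n]$. A family $\mathcal{F}$ is intersecting if $F\cap F'\neq\varnothing$ for all $F,F'\in\mathcal{F}$. For a family $\mathcal{F}$, $\mathcal{D}(\mathcal{F}) := \{F\setminus F' : F,F'\in\mathcal{F}\}$ is the family of setwise differences. -}

module Defs where

open import Data.Nat using (ℕ; _∸_)
open import Data.Nat.Combinatorics using (_C_)
open import Data.Bool.Properties using () renaming (_≟_ to _≟ᵇ_)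
open import Data.List using (List; []; _∷_; map; concatMap; deduplicate; length; upTo)
open import Data.Nat.ListAction using (sum)
open import Data.List.Membership.Propositional using (_∈_)
open import Data.Fin.Subset using (Subset; _─_; _∩_; ∣_∣; Nonempty)
open import Data.Vec.Properties using (≡-dec)
open import Relation.Binary.PropositionalEquality using (_≡_)

-- A family of subsets of [n] is represented by a list of subsets (duplicates irrelevant).
Family : ℕ → Set
Family n = List (Subset n)

Uniform : ∀ {n} → ℕ → Family n → Set
Uniform k 𝓕 = ∀ {F} → F ∈ 𝓕 → ∣ F ∣ ≡ k

Intersecting : ∀ {n} → Family n → Set
Intersecting 𝓕 = ∀ {F G} → F ∈ 𝓕 → G ∈ 𝓕 → Nonempty (F ∩ G)

diffList : ∀ {n} → Family n → List (Subset n)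
diffList 𝓕 = concatMap (λ F → map (λ G → F ─ G) 𝓕) 𝓕

D : ∀ {n} → Family n → List (Subset n)
D 𝓕 = deduplicate (≡-dec _≟ᵇ_) (diffList 𝓕)

∣D∣ : ∀ {n} → Family n → ℕ
∣D∣ 𝓕 = length (D 𝓕)

binomSum : ℕ → ℕ → ℕ
binomSum n k = sum (map (λ ℓ → (n ∸ 1) C ℓ) (upTo k))

-- Write n = 1 + k + N and split the ground set as {0} ⊎ B ⊎ R with |B| = k and |R| = N.
-- The family 𝓕 consists of B and of all sets {0} ∪ X with |X| = k − 1 and X ∩ B ≠ ∅; it is
-- k-uniform and intersecting.  Differences of two sets through 0 give every Z ⊆ B ∪ R with
-- |Z| ≤ k − 1 except the (k − 1)-subsets of R, and the differences ({0} ∪ X) ∖ B give {0} ∪ W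
-- for every W ⊆ R with |W| < k − 1.  Hence, with m = k − 1,
--   |D(𝓕)| ≥ Σ_{ℓ<k} C(n − 1, ℓ) − C(N, m) + Σ_{ℓ<m} C(N, ℓ),
-- and it remains to show C(N, m) < Σ_{ℓ<m} C(N, ℓ).  Since N ≈ (c − 1) m with c < 4, the
-- ratio C(N, ℓ + 1) / C(N, ℓ) = (N − ℓ) / (ℓ + 1) stays below some b / a < 2 for ℓ near m, so
-- going down from C(N, m) the binomials decay at most geometrically with ratio a / b > 1 / 2,
-- and boundedly many of them already outweigh C(N, m).

module Submission where

open import Defs
open import Data.Nat
open import Data.Nat.Properties
open import Data.Nat.Combinatorics using (_C_; nC1≡n) renaming (nCk+nC[k+1]≡[n+1]C[k+1] to pascal)
open import Data.Nat.Tactic.RingSolver using (solve-∀)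
open import Data.Nat.ListAction using (sum)
open import Data.Nat.ListAction.Properties using (sum-++)
open import Algebra.Properties.CommutativeSemigroup +-commutativeSemigroup using (xy∙z≈xz∙y)
open import Data.Empty using (⊥-elim)
open import Data.Product using (Σ; ∃; _×_; _,_; proj₁; proj₂)
open import Data.Sum using (_⊎_; inj₁; inj₂)
open import Data.Bool.Properties using () renaming (_≟_ to _≟ᵇ_)
open import Data.Fin.Base using (Fin; zero; suc)
open import Data.Fin.Properties using (injective⇒≤)
open import Data.Fin.Subset using (Subset; inside; outside; ∣_∣; _∪_; _∩_; _─_; ⊤; ⊥; Nonempty)
open import Data.Fin.Subset.Properties using (∣⊤∣≡n; ∣⊥∣≡0; ∩-comm; p─⊤≡⊥; p─⊥≡p)
open import Data.Vec.Base using ([]; _∷_; _++_) renaming (here to hereᵥ; there to thereᵥ)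
open import Data.Vec.Properties using (≡-dec; ∷-injectiveʳ; ++-injectiveʳ; zipWith-++)
open import Data.List using (List; []; _∷_; [_]; map; length; lookup; filter; upTo) renaming (_++_ to _++ₗ_)
open import Data.List.Properties using (length-++; length-map; map-++; applyUpTo-∷ʳ)
open import Data.List.Membership.Propositional using (_∈_)
open import Data.List.Membership.Propositional.Properties
  using (∈-map⁺; ∈-map⁻; ∈-++⁺ˡ; ∈-++⁺ʳ; ∈-++⁻; ∈-lookup; ∈-filter⁺; ∈-filter⁻; ∈-deduplicate⁺; ∈-concat⁺′)
import Data.List.Membership.Setoid.Properties as Membershipₛ
open import Data.List.Relation.Unary.Any using (index; here; there)
open import Data.List.Relation.Unary.All as All using ([])
open import Data.List.Relation.Unary.AllPairs using ([]; _∷_)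
open import Data.List.Relation.Unary.Unique.Propositional using (Unique)
import Data.List.Relation.Unary.Unique.Propositional.Properties as Unique
open import Data.List.Relation.Binary.Disjoint.Propositional using (Disjoint)
open import Data.List.Relation.Binary.Subset.Propositional using (_⊆_)
open import Function using (_∘_)
open import Relation.Nullary using (Dec; yes; no; _×-dec_)
open import Relation.Nullary.Decidable using (map′)
open import Relation.Unary using (Decidable)
open import Relation.Binary.PropositionalEquality
  using (_≡_; refl; sym; trans; cong; cong₂; subst; subst₂; setoid; module ≡-Reasoning)

∑< : (ℕ → ℕ) → ℕ → ℕ
∑< f zero    = 0
∑< f (suc r) = ∑< f r + f r

syntax ∑< (λ i → e) r = ∑[ i < r ] e

sum-map-upTo : ∀ f r → sum (map f (upTo r)) ≡ ∑< f r
sum-map-upTo f zero    = refl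
sum-map-upTo f (suc r) = begin
  sum (map f (upTo (suc r)))         ≡⟨ cong (sum ∘ map f) (applyUpTo-∷ʳ (λ i → i) r) ⟨
  sum (map f (upTo r ++ₗ [ r ]))     ≡⟨ cong sum (map-++ f (upTo r) [ r ]) ⟩
  sum (map f (upTo r) ++ₗ [ f r ])   ≡⟨ sum-++ (map f (upTo r)) [ f r ] ⟩
  sum (map f (upTo r)) + (f r + 0)   ≡⟨ cong₂ _+_ (sum-map-upTo f r) (+-identityʳ (f r)) ⟩
  ∑< f r + f r                       ∎
  where open ≡-Reasoning

∑<-+ : ∀ f s J → ∑< f (s + J) ≡ ∑< f s + ∑[ i < J ] f (s + i)
∑<-+ f s zero    = trans (cong (∑< f) (+-identityʳ s)) (sym (+-identityʳ _))
∑<-+ f s (suc J) = begin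
  ∑< f (s + suc J)                                ≡⟨ cong (∑< f) (+-suc s J) ⟩
  ∑< f (s + J) + f (s + J)                        ≡⟨ cong (_+ f (s + J)) (∑<-+ f s J) ⟩
  ∑< f s + ∑[ i < J ] f (s + i) + f (s + J)       ≡⟨ +-assoc (∑< f s) _ _ ⟩
  ∑< f s + (∑[ i < J ] f (s + i) + f (s + J))     ∎
  where open ≡-Reasoning

∑<-window-≤ : ∀ f s J → ∑[ i < J ] f (s + i) ≤ ∑< f (s + J)
∑<-window-≤ f s J = subst (∑[ i < J ] f (s + i) ≤_) (sym (∑<-+ f s J)) (m≤n+m _ (∑< f s))

C-absorption : ∀ n k → suc k * (suc n C suc k) ≡ suc n * (n C k)
C-absorption zero    zero    = refl
C-absorption zero    (suc k) = *-zeroʳ (suc (suc k))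
C-absorption (suc n) zero    = trans (+-identityʳ _) (trans (nC1≡n (suc (suc n))) (sym (*-identityʳ _)))
C-absorption (suc n) (suc k) = begin
  suc (suc k) * (suc (suc n) C suc (suc k))        ≡⟨ cong (suc (suc k) *_) (pascal (suc n) (suc k)) ⟨
  suc (suc k) * (X + Y)                            ≡⟨ regroupˡ k X Y ⟩
  X + suc k * X + suc (suc k) * Y
    ≡⟨ cong₂ (λ u v → X + u + v) (C-absorption n k) (C-absorption n (suc k)) ⟩
  X + suc n * P + suc n * Q                        ≡⟨ cong (λ u → u + suc n * P + suc n * Q) (pascal n k) ⟨
  (P + Q) + suc n * P + suc n * Q                  ≡⟨ regroupʳ n P Q ⟩
  suc (suc n) * (P + Q)                            ≡⟨ cong (suc (suc n) *_) (pascal n k) ⟩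
  suc (suc n) * (suc n C suc k)                    ∎
  where
  open ≡-Reasoning
  X = suc n C suc k
  Y = suc n C suc (suc k)
  P = n C k
  Q = n C suc k
  regroupˡ : ∀ k X Y → suc (suc k) * (X + Y) ≡ X + suc k * X + suc (suc k) * Y
  regroupˡ = solve-∀
  regroupʳ : ∀ n P Q → (P + Q) + suc n * P + suc n * Q ≡ suc (suc n) * (P + Q)
  regroupʳ = solve-∀

C-ratio : ∀ ℓ d → suc ℓ * ((ℓ + d) C suc ℓ) ≡ d * ((ℓ + d) C ℓ)
C-ratio ℓ d = +-cancelˡ-≡ (suc ℓ * X) _ _ (begin
  suc ℓ * X + suc ℓ * Y                ≡⟨ *-distribˡ-+ (suc ℓ) X Y ⟨
  suc ℓ * (X + Y)                      ≡⟨ cong (suc ℓ *_) (pascal (ℓ + d) ℓ) ⟩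
  suc ℓ * (suc (ℓ + d) C suc ℓ)        ≡⟨ C-absorption (ℓ + d) ℓ ⟩
  (suc ℓ + d) * X                      ≡⟨ *-distribʳ-+ X (suc ℓ) d ⟩
  suc ℓ * X + d * X                    ∎)
  where
  open ≡-Reasoning
  X = (ℓ + d) C ℓ
  Y = (ℓ + d) C suc ℓ

C-step : ∀ ℓ d {a b} → a * d ≤ suc ℓ * b → ((ℓ + d) C suc ℓ) * a ≤ ((ℓ + d) C ℓ) * b
C-step ℓ d {a} {b} ad≤ = *-cancelˡ-≤ (suc ℓ) (begin
  suc ℓ * (X * a)      ≡⟨ *-assoc (suc ℓ) X a ⟨
  suc ℓ * X * a        ≡⟨ cong (_* a) (C-ratio ℓ d) ⟩
  d * Y * a            ≡⟨ swap d Y a ⟩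
  Y * (a * d)          ≤⟨ *-monoʳ-≤ Y ad≤ ⟩
  Y * (suc ℓ * b)      ≡⟨ swap′ Y (suc ℓ) b ⟩
  suc ℓ * (Y * b)      ∎)
  where
  open ≤-Reasoning
  X = (ℓ + d) C suc ℓ
  Y = (ℓ + d) C ℓ
  swap : ∀ d Y a → d * Y * a ≡ Y * (a * d)
  swap = solve-∀
  swap′ : ∀ Y l b → Y * (l * b) ≡ l * (Y * b)
  swap′ = solve-∀

C-pos : ∀ {n k} → k ≤ n → 0 < n C k
C-pos {n}     {zero}  _         = s≤s z≤n
C-pos {suc n} {suc k} (s≤s k≤n) =
  subst (0 <_) (pascal n k) (≤-trans (C-pos k≤n) (m≤m+n (n C k) _))

∑<-pascal : ∀ M r → ∑[ ℓ < suc r ] (suc M C ℓ) ≡ ∑[ ℓ < suc r ] (M C ℓ) + ∑[ ℓ < r ] (M C ℓ)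
∑<-pascal M zero    = refl
∑<-pascal M (suc r) = begin
  ∑[ ℓ < suc r ] (suc M C ℓ) + suc M C suc r      ≡⟨ cong₂ _+_ (∑<-pascal M r) (sym (pascal M r)) ⟩
  (S + M C r) + S + (M C r + M C suc r)           ≡⟨ regroup S (M C r) (M C suc r) ⟩
  (S + M C r + M C suc r) + (S + M C r)           ∎
  where
  open ≡-Reasoning
  S = ∑[ ℓ < r ] (M C ℓ)
  regroup : ∀ s x y → (s + x) + s + (x + y) ≡ (s + x + y) + (s + x)
  regroup = solve-∀

geometricSum : ℕ → ℕ → ℕ → ℕ
geometricSum a b zero    = 0
geometricSum a b (suc J) = a * (b ^ J + geometricSum a b J)

geometricSum-tail : ∀ {a b} (g : ℕ → ℕ) J → (∀ i → i < J → g (suc i) * a ≤ g i * b) →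
                    g J * geometricSum a b J ≤ b ^ J * ∑< g J
geometricSum-tail g zero    _     = ≤-reflexive (*-zeroʳ (g 0))
geometricSum-tail {a} {b} g (suc J) ratio = begin
  g (suc J) * (a * (b ^ J + G))           ≡⟨ *-assoc (g (suc J)) a _ ⟨
  g (suc J) * a * (b ^ J + G)             ≤⟨ *-monoˡ-≤ (b ^ J + G) (ratio J ≤-refl) ⟩
  g J * b * (b ^ J + G)                   ≡⟨ expand (g J) b (b ^ J) G ⟩
  b * b ^ J * g J + b * (g J * G)         ≤⟨ +-monoʳ-≤ (b * b ^ J * g J) (*-monoʳ-≤ b tail) ⟩
  b * b ^ J * g J + b * (b ^ J * ∑< g J)  ≡⟨ collect (g J) b (b ^ J) (∑< g J) ⟩
  b * b ^ J * (∑< g J + g J)              ∎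
  where
  open ≤-Reasoning
  G = geometricSum a b J
  tail : g J * G ≤ b ^ J * ∑< g J
  tail = geometricSum-tail g J (λ i i<J → ratio i (m<n⇒m<1+n i<J))
  expand : ∀ x b B G → x * b * (B + G) ≡ b * B * x + b * (x * G)
  expand = solve-∀
  collect : ∀ x b B S → b * B * x + b * (B * S) ≡ b * B * (S + x)
  collect = solve-∀

last<∑< : ∀ {a b} (g : ℕ → ℕ) J → (∀ i → i < J → g (suc i) * a ≤ g i * b) →
                       b ^ J < geometricSum a b J → 0 < g J → g J < ∑< g J
last<∑< {a} {b} g J ratio bᴶ<G 0<gJ = *-cancelˡ-< (b ^ J) _ _ (begin-strict
  b ^ J * g J                 ≡⟨ *-comm (b ^ J) (g J) ⟩
  g J * b ^ J                 <⟨ *-monoʳ-< (g J) {{>-nonZero 0<gJ}} bᴶ<G ⟩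
  g J * geometricSum a b J    ≤⟨ geometricSum-tail g J ratio ⟩
  b ^ J * ∑< g J              ∎)
  where open ≤-Reasoning

geometricSum-closed : ∀ a q J → geometricSum a (a + q) J * q + a ^ suc J ≡ a * (a + q) ^ J
geometricSum-closed a q zero    = refl
geometricSum-closed a q (suc J) = begin
  a * (B + G) * q + a * a ^ suc J       ≡⟨ regroup a q B G (a ^ suc J) ⟩
  a * (B * q + (G * q + a ^ suc J))     ≡⟨ cong (λ u → a * (B * q + u)) (geometricSum-closed a q J) ⟩
  a * (B * q + a * B)                   ≡⟨ cong (a *_) (factor a q B) ⟩
  a * ((a + q) * B)                     ∎
  where
  open ≡-Reasoning
  B = (a + q) ^ J
  G = geometricSum a (a + q) J
  regroup : ∀ a q B G A → a * (B + G) * q + a * A ≡ a * (B * q + (G * q + A))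
  regroup = solve-∀
  factor : ∀ a q B → B * q + a * B ≡ (a + q) * B
  factor = solve-∀

bernoulli : ∀ x y J → x ^ J * (x + suc J * y) ≤ (x + y) ^ suc J
bernoulli x y zero    = ≤-reflexive (base x y)
  where
  base : ∀ x y → 1 * (x + 1 * y) ≡ (x + y) * 1
  base = solve-∀
bernoulli x y (suc J) = begin
  x * x ^ J * (x + suc (suc J) * y)                                  ≤⟨ m≤m+n _ (x ^ J * (suc J * (y * y))) ⟩
  x * x ^ J * (x + suc (suc J) * y) + x ^ J * (suc J * (y * y))      ≡⟨ factor x y (x ^ J) J ⟩
  (x + y) * (x ^ J * (x + suc J * y))                                ≤⟨ *-monoʳ-≤ (x + y) (bernoulli x y J) ⟩
  (x + y) * (x + y) ^ suc J                                          ∎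
  where
  open ≤-Reasoning
  factor : ∀ x y P J → x * P * (x + suc (suc J) * y) + P * (suc J * (y * y)) ≡ (x + y) * (P * (x + suc J * y))
  factor = solve-∀

pow-suc<pow : ∀ q → 0 < q → suc q ^ (3 + q) < (suc q + q) ^ (2 + q)
pow-suc<pow q 0<q = begin-strict
  a ^ (3 + q)                         ≡⟨ split a (a ^ q) ⟩
  a ^ (1 + q) * (a * a)               <⟨ *-monoʳ-< (a ^ (1 + q)) {{m^n≢0 a (1 + q)}} a²< ⟩
  a ^ (1 + q) * (a + (2 + q) * q)     ≤⟨ bernoulli a q (1 + q) ⟩
  (a + q) ^ (2 + q)                   ∎
  where
  open ≤-Reasoning
  a = suc q
  split : ∀ a A → a * (a * (a * A)) ≡ (a * A) * (a * a)
  split = solve-∀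
  square : ∀ q → suc q + (2 + q) * q ≡ suc q * suc q + q
  square = solve-∀
  a²< : a * a < a + (2 + q) * q
  a²< = subst (a * a <_) (sym (square q)) (m<m+n (a * a) 0<q)

geometricSum-exceeds : ∀ q → 0 < q → (suc q + q) ^ (2 + q) < geometricSum (suc q) (suc q + q) (2 + q)
geometricSum-exceeds q 0<q = *-cancelʳ-< q _ _ (+-cancelʳ-< (a ^ (3 + q)) _ _ (begin-strict
  B * q + a ^ (3 + q)       <⟨ +-monoʳ-< (B * q) (pow-suc<pow q 0<q) ⟩
  B * q + B                 ≡⟨ factor q B ⟩
  a * B                     ≡⟨ geometricSum-closed a q (2 + q) ⟨
  G * q + a ^ (3 + q)       ∎))
  where
  open ≤-Reasoning
  a = suc q
  B = (a + q) ^ (2 + q)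
  G = geometricSum a (a + q) (2 + q)
  factor : ∀ q B → B * q + B ≡ suc q * B
  factor = solve-∀

C<∑< : ∀ {a b J N s} → b ^ J < geometricSum a b J → s + J ≤ N → a * (N ∸ s) ≤ suc s * b →
       N C (s + J) < ∑[ ℓ < s + J ] (N C ℓ)
C<∑< {a} {b} {J} {N} {s} bᴶ<G s+J≤N ratio₀ = begin-strict
  N C (s + J)                 <⟨ last<∑< g J ratio bᴶ<G (C-pos s+J≤N) ⟩
  ∑[ i < J ] (N C (s + i))    ≤⟨ ∑<-window-≤ (N C_) s J ⟩
  ∑[ ℓ < s + J ] (N C ℓ)      ∎
  where
  open ≤-Reasoning
  g : ℕ → ℕ
  g i = N C (s + i)
  ratio : ∀ i → i < J → g (suc i) * a ≤ g i * b
  ratio i i<J = subst (λ u → (N C u) * a ≤ g i * b) (sym (+-suc s i))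
    (subst (λ n → (n C suc ℓ) * a ≤ (n C ℓ) * b) (m+[n∸m]≡n ℓ≤N) (C-step ℓ (N ∸ ℓ) (begin
      a * (N ∸ ℓ)       ≤⟨ *-monoʳ-≤ a (∸-monoʳ-≤ N (m≤m+n s i)) ⟩
      a * (N ∸ s)       ≤⟨ ratio₀ ⟩
      suc s * b         ≤⟨ *-monoˡ-≤ b (s≤s (m≤m+n s i)) ⟩
      suc ℓ * b         ∎)))
    where
    ℓ = s + i
    ℓ≤N : ℓ ≤ N
    ℓ≤N = ≤-trans (+-monoʳ-≤ s (<⇒≤ i<J)) s+J≤N

lookup-injective : ∀ {A : Set} {xs : List A} → Unique xs → ∀ {i j} → lookup xs i ≡ lookup xs j → i ≡ j
lookup-injective {xs = _ ∷ _}  (_ ∷ _)  {zero}  {zero}  _  = refl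
lookup-injective {xs = _ ∷ _}  (x≢ ∷ _) {zero}  {suc j} eq = ⊥-elim (All.lookup x≢ (∈-lookup j) eq)
lookup-injective {xs = _ ∷ _}  (x≢ ∷ _) {suc i} {zero}  eq = ⊥-elim (All.lookup x≢ (∈-lookup i) (sym eq))
lookup-injective {xs = _ ∷ xs} (_ ∷ u)  {suc i} {suc j} eq = cong suc (lookup-injective u eq)

Unique-⊆⇒length-≤ : ∀ {A : Set} {xs ys : List A} → Unique xs → xs ⊆ ys → length xs ≤ length ys
Unique-⊆⇒length-≤ {xs = xs} u xs⊆ys = injective⇒≤ {f = position} λ {i} {j} eq →
  lookup-injective u (Membershipₛ.index-injective (setoid _) (xs⊆ys (∈-lookup i)) (xs⊆ys (∈-lookup j)) eq)
  where
  position : Fin (length xs) → Fin _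
  position i = index (xs⊆ys (∈-lookup i))

branch : ∀ {M} → List (Subset M) → List (Subset M) → List (Subset (suc M))
branch xs ys = map (outside ∷_) xs ++ₗ map (inside ∷_) ys

module _ {M} {xs ys : List (Subset M)} where

  ∈-branch⁺ˡ : ∀ {x} → x ∈ xs → outside ∷ x ∈ branch xs ys
  ∈-branch⁺ˡ x∈ = ∈-++⁺ˡ (∈-map⁺ (outside ∷_) x∈)

  ∈-branch⁺ʳ : ∀ {y} → y ∈ ys → inside ∷ y ∈ branch xs ys
  ∈-branch⁺ʳ y∈ = ∈-++⁺ʳ (map (outside ∷_) xs) (∈-map⁺ (inside ∷_) y∈)

  ∈-branch⁻ˡ : ∀ {x} → outside ∷ x ∈ branch xs ys → x ∈ xs
  ∈-branch⁻ˡ x∈ with ∈-++⁻ (map (outside ∷_) xs) x∈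
  ... | inj₁ x∈ˡ with ∈-map⁻ (outside ∷_) x∈ˡ
  ...   | _ , x∈xs , refl = x∈xs
  ∈-branch⁻ˡ x∈ | inj₂ x∈ʳ with ∈-map⁻ (inside ∷_) x∈ʳ
  ...   | _ , _ , ()

  ∈-branch⁻ʳ : ∀ {y} → inside ∷ y ∈ branch xs ys → y ∈ ys
  ∈-branch⁻ʳ y∈ with ∈-++⁻ (map (outside ∷_) xs) y∈
  ... | inj₁ y∈ˡ with ∈-map⁻ (outside ∷_) y∈ˡ
  ...   | _ , _ , ()
  ∈-branch⁻ʳ y∈ | inj₂ y∈ʳ with ∈-map⁻ (inside ∷_) y∈ʳ
  ...   | _ , y∈ys , refl = y∈ys

  branch-unique : Unique xs → Unique ys → Unique (branch xs ys)
  branch-unique uxs uys = Unique.++⁺ (Unique.map⁺ ∷-injectiveʳ uxs) (Unique.map⁺ ∷-injectiveʳ uys) disjoint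
    where
    disjoint : Disjoint (map (outside ∷_) xs) (map (inside ∷_) ys)
    disjoint (v∈xs , v∈ys) with ∈-map⁻ (outside ∷_) v∈xs | ∈-map⁻ (inside ∷_) v∈ys
    ... | _ , _ , refl | _ , _ , ()

length-branch : ∀ {M} (xs ys : List (Subset M)) → length (branch xs ys) ≡ length xs + length ys
length-branch xs ys = trans (length-++ (map (outside ∷_) xs))
                            (cong₂ _+_ (length-map (outside ∷_) xs) (length-map (inside ∷_) ys))

subsetsBelow : ∀ M → ℕ → List (Subset M)
subsetsBelow M       zero    = []
subsetsBelow zero    (suc r) = [] ∷ []
subsetsBelow (suc M) (suc r) = branch (subsetsBelow M (suc r)) (subsetsBelow M r)

∈-subsetsBelow⁺ : ∀ {M r} (x : Subset M) → ∣ x ∣ < r → x ∈ subsetsBelow M r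
∈-subsetsBelow⁺ {r = suc r} []            _           = here refl
∈-subsetsBelow⁺ {r = suc r} (outside ∷ x) ∣x∣<r       = ∈-branch⁺ˡ (∈-subsetsBelow⁺ x ∣x∣<r)
∈-subsetsBelow⁺ {r = suc r} (inside ∷ x)  (s≤s ∣x∣<r) = ∈-branch⁺ʳ (∈-subsetsBelow⁺ x ∣x∣<r)

∈-subsetsBelow⁻ : ∀ {M r} {x : Subset M} → x ∈ subsetsBelow M r → ∣ x ∣ < r
∈-subsetsBelow⁻ {zero}  {suc r} {[]}          _  = s≤s z≤n
∈-subsetsBelow⁻ {suc M} {suc r} {outside ∷ x} x∈ = ∈-subsetsBelow⁻ (∈-branch⁻ˡ x∈)
∈-subsetsBelow⁻ {suc M} {suc r} {inside ∷ x}  x∈ = s≤s (∈-subsetsBelow⁻ (∈-branch⁻ʳ x∈))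

subsetsBelow-unique : ∀ M r → Unique (subsetsBelow M r)
subsetsBelow-unique M       zero    = []
subsetsBelow-unique zero    (suc r) = [] ∷ []
subsetsBelow-unique (suc M) (suc r) = branch-unique (subsetsBelow-unique M (suc r)) (subsetsBelow-unique M r)

∑<-0C : ∀ r → ∑[ ℓ < suc r ] (0 C ℓ) ≡ 1
∑<-0C zero    = refl
∑<-0C (suc r) = trans (+-identityʳ _) (∑<-0C r)

length-subsetsBelow : ∀ M r → length (subsetsBelow M r) ≡ ∑[ ℓ < r ] (M C ℓ)
length-subsetsBelow M       zero    = refl
length-subsetsBelow zero    (suc r) = sym (∑<-0C r)
length-subsetsBelow (suc M) (suc r) = begin
  length (branch below₁ below₀)               ≡⟨ length-branch below₁ below₀ ⟩
  length below₁ + length below₀               ≡⟨ cong₂ _+_ (length-subsetsBelow M (suc r)) (length-subsetsBelow M r) ⟩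
  ∑[ ℓ < suc r ] (M C ℓ) + ∑[ ℓ < r ] (M C ℓ) ≡⟨ ∑<-pascal M r ⟨
  ∑[ ℓ < suc r ] (suc M C ℓ)                  ∎
  where
  open ≡-Reasoning
  below₁ = subsetsBelow M (suc r)
  below₀ = subsetsBelow M r

data MeetsFirst {N : ℕ} : ∀ a → Subset (a + N) → Set where
  here  : ∀ {a x} → MeetsFirst (suc a) (inside ∷ x)
  there : ∀ {a s x} → MeetsFirst a x → MeetsFirst (suc a) (s ∷ x)

meetsFirst? : ∀ {N} a (x : Subset (a + N)) → Dec (MeetsFirst a x)
meetsFirst? zero    x             = no λ ()
meetsFirst? (suc a) (inside ∷ x)  = yes here
meetsFirst? (suc a) (outside ∷ x) = map′ there (λ { (there m) → m }) (meetsFirst? a x)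

meetsFirst-∪ˡ : ∀ {N a} {x : Subset (a + N)} y → MeetsFirst a x → MeetsFirst a (x ∪ y)
meetsFirst-∪ˡ (_ ∷ y) here      = here
meetsFirst-∪ˡ (_ ∷ y) (there m) = there (meetsFirst-∪ˡ y m)

meetsFirst-∪ʳ : ∀ {N a} (x : Subset (a + N)) {y} → MeetsFirst a y → MeetsFirst a (x ∪ y)
meetsFirst-∪ʳ (inside ∷ x)  here      = here
meetsFirst-∪ʳ (outside ∷ x) here      = here
meetsFirst-∪ʳ (_ ∷ x)       (there m) = there (meetsFirst-∪ʳ x m)

meetsFirst-++ : ∀ {a N} (e : Subset a) (w : Subset N) → 0 < ∣ e ∣ → MeetsFirst a (e ++ w)
meetsFirst-++ (inside ∷ e)  w _      = here
meetsFirst-++ (outside ∷ e) w 0<∣e∣ = there (meetsFirst-++ e w 0<∣e∣)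

meetsFirst⇒nonempty : ∀ {N a} {x : Subset (a + N)} → MeetsFirst a x → Nonempty (x ∩ (⊤ {a} ++ ⊥ {N}))
meetsFirst⇒nonempty here      = zero , hereᵥ
meetsFirst⇒nonempty (there m) with meetsFirst⇒nonempty m
... | i , i∈ = suc i , thereᵥ i∈

firstFree : ∀ {M} → ℕ → Subset M → Subset M
firstFree t       []            = []
firstFree zero    (_ ∷ x)       = outside ∷ firstFree zero x
firstFree (suc t) (inside ∷ x)  = outside ∷ firstFree (suc t) x
firstFree (suc t) (outside ∷ x) = inside ∷ firstFree t x

∣firstFree-zero∣ : ∀ {M} (x : Subset M) → ∣ firstFree zero x ∣ ≡ 0
∣firstFree-zero∣ []      = refl
∣firstFree-zero∣ (_ ∷ x) = ∣firstFree-zero∣ x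

∣firstFree∣ : ∀ {M} t (x : Subset M) → t + ∣ x ∣ ≤ M → ∣ firstFree t x ∣ ≡ t
∣firstFree∣ zero    x             _          = ∣firstFree-zero∣ x
∣firstFree∣ {suc M} (suc t) (inside ∷ x) (s≤s room) = ∣firstFree∣ (suc t) x (subst (_≤ M) (+-suc t ∣ x ∣) room)
∣firstFree∣ (suc t) (outside ∷ x) (s≤s room)   = cong suc (∣firstFree∣ t x room)

∣∪firstFree∣ : ∀ {M} t (x : Subset M) → ∣ x ∪ firstFree t x ∣ ≡ ∣ x ∣ + ∣ firstFree t x ∣
∣∪firstFree∣ t       []            = refl
∣∪firstFree∣ zero    (inside ∷ x)  = cong suc (∣∪firstFree∣ zero x)
∣∪firstFree∣ zero    (outside ∷ x) = ∣∪firstFree∣ zero x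
∣∪firstFree∣ (suc t) (inside ∷ x)  = cong suc (∣∪firstFree∣ (suc t) x)
∣∪firstFree∣ (suc t) (outside ∷ x) = trans (cong suc (∣∪firstFree∣ t x)) (sym (+-suc ∣ x ∣ _))

∪firstFree─firstFree : ∀ {M} {t r} (x : Subset M) → t ≤ r → (x ∪ firstFree t x) ─ firstFree r x ≡ x
∪firstFree─firstFree []                                    _         = refl
∪firstFree─firstFree {t = zero}  {zero}  (inside ∷ x)  _         = cong (inside ∷_) (∪firstFree─firstFree x z≤n)
∪firstFree─firstFree {t = zero}  {zero}  (outside ∷ x) _         = cong (outside ∷_) (∪firstFree─firstFree x z≤n)
∪firstFree─firstFree {t = zero}  {suc r} (inside ∷ x)  _         = cong (inside ∷_) (∪firstFree─firstFree x z≤n)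
∪firstFree─firstFree {t = zero}  {suc r} (outside ∷ x) _         = cong (outside ∷_) (∪firstFree─firstFree x z≤n)
∪firstFree─firstFree {t = suc t} {suc r} (inside ∷ x)  t≤r       = cong (inside ∷_) (∪firstFree─firstFree x t≤r)
∪firstFree─firstFree {t = suc t} {suc r} (outside ∷ x) (s≤s t≤r) = cong (outside ∷_) (∪firstFree─firstFree x t≤r)

meetsFirst-firstFree : ∀ {N a t} (x : Subset (a + N)) → 0 < t → ∣ x ∣ < a → MeetsFirst a (firstFree t x)
meetsFirst-firstFree {a = suc a} {suc t} (inside ∷ x)  0<t (s≤s ∣x∣<a) = there (meetsFirst-firstFree x 0<t ∣x∣<a)
meetsFirst-firstFree {a = suc a} {suc t} (outside ∷ x) _   _          = here

∣++∣ : ∀ {a N} (e : Subset a) (w : Subset N) → ∣ e ++ w ∣ ≡ ∣ e ∣ + ∣ w ∣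
∣++∣ []            w = refl
∣++∣ (inside ∷ e)  w = cong suc (∣++∣ e w)
∣++∣ (outside ∷ e) w = ∣++∣ e w

nonempty-∷ : ∀ {M s} {x : Subset M} → Nonempty x → Nonempty (s ∷ x)
nonempty-∷ (i , i∈x) = suc i , thereᵥ i∈x

module _ (N m : ℕ) where

  -- the subsets of size ≤ m, except those of size m that avoid the first a points
  lowOrMeeting : ∀ a → List (Subset (a + N))
  lowOrMeeting zero    = subsetsBelow N m
  lowOrMeeting (suc a) = branch (lowOrMeeting a) (subsetsBelow (a + N) m)

  ∈-lowOrMeeting⁻ : ∀ a {x} → x ∈ lowOrMeeting a → ∣ x ∣ ≤ m × (MeetsFirst a x ⊎ ∣ x ∣ < m)
  ∈-lowOrMeeting⁻ zero          x∈ = <⇒≤ (∈-subsetsBelow⁻ x∈) , inj₂ (∈-subsetsBelow⁻ x∈)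
  ∈-lowOrMeeting⁻ (suc a) {inside ∷ x}  x∈ = ∈-subsetsBelow⁻ (∈-branch⁻ʳ x∈) , inj₁ here
  ∈-lowOrMeeting⁻ (suc a) {outside ∷ x} x∈ with ∈-lowOrMeeting⁻ a (∈-branch⁻ˡ x∈)
  ... | ∣x∣≤m , inj₁ meets = ∣x∣≤m , inj₁ (there meets)
  ... | ∣x∣≤m , inj₂ ∣x∣<m = ∣x∣≤m , inj₂ ∣x∣<m

  lowOrMeeting-unique : ∀ a → Unique (lowOrMeeting a)
  lowOrMeeting-unique zero    = subsetsBelow-unique N m
  lowOrMeeting-unique (suc a) = branch-unique (lowOrMeeting-unique a) (subsetsBelow-unique (a + N) m)

  length-lowOrMeeting : ∀ a → length (lowOrMeeting a) + N C m ≡ ∑[ ℓ < suc m ] ((a + N) C ℓ)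
  length-lowOrMeeting zero    = cong (_+ N C m) (length-subsetsBelow N m)
  length-lowOrMeeting (suc a) = begin
    length (branch (lowOrMeeting a) (subsetsBelow (a + N) m)) + N C m
      ≡⟨ cong (_+ N C m) (trans (length-branch (lowOrMeeting a) (subsetsBelow (a + N) m))
                                (cong (length (lowOrMeeting a) +_) (length-subsetsBelow (a + N) m))) ⟩
    length (lowOrMeeting a) + S + N C m     ≡⟨ xy∙z≈xz∙y (length (lowOrMeeting a)) S (N C m) ⟩
    length (lowOrMeeting a) + N C m + S     ≡⟨ cong (_+ S) (length-lowOrMeeting a) ⟩
    ∑[ ℓ < suc m ] ((a + N) C ℓ) + S        ≡⟨ ∑<-pascal (a + N) m ⟨
    ∑[ ℓ < suc m ] (suc (a + N) C ℓ)        ∎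
    where
    open ≡-Reasoning
    S = ∑[ ℓ < m ] ((a + N) C ℓ)

module Construction (N m : ℕ) (0<m : 0 < m) (m≤N : m ≤ N) where

  k : ℕ
  k = suc m

  -- Point 0 is coordinate zero, and B consists of the next k coordinates.
  block : Subset (suc (k + N))
  block = outside ∷ (⊤ {k} ++ ⊥ {N})

  Admissible : Subset (k + N) → Set
  Admissible x = ∣ x ∣ ≡ m × MeetsFirst k x

  admissible? : Decidable Admissible
  admissible? x = ∣ x ∣ ≟ m ×-dec meetsFirst? k x

  𝓕 : Family (suc (k + N))
  𝓕 = block ∷ map (inside ∷_) (filter admissible? (subsetsBelow (k + N) k))

  ∈𝓕⁺ : ∀ {x} → Admissible x → inside ∷ x ∈ 𝓕
  ∈𝓕⁺ {x} adm@(∣x∣≡m , _) =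
    there (∈-map⁺ (inside ∷_) (∈-filter⁺ admissible? (∈-subsetsBelow⁺ x (s≤s (≤-reflexive ∣x∣≡m))) adm))

  ∈𝓕⁻ : ∀ {F} → F ∈ 𝓕 → F ≡ block ⊎ ∃ λ x → F ≡ inside ∷ x × Admissible x
  ∈𝓕⁻ (here F≡block) = inj₁ F≡block
  ∈𝓕⁻ (there F∈)     with ∈-map⁻ (inside ∷_) F∈
  ... | x , x∈ , F≡ = inj₂ (x , F≡ , proj₂ (∈-filter⁻ admissible? {xs = subsetsBelow (k + N) k} x∈))

  uniform : Uniform k 𝓕
  uniform F∈ with ∈𝓕⁻ F∈
  ... | inj₁ refl                   =
    trans (∣++∣ (⊤ {k}) (⊥ {N})) (trans (cong₂ _+_ (∣⊤∣≡n k) (∣⊥∣≡0 N)) (+-identityʳ k))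
  ... | inj₂ (x , refl , ∣x∣≡m , _) = cong suc ∣x∣≡m

  intersecting : Intersecting 𝓕
  intersecting F∈ G∈ with ∈𝓕⁻ F∈ | ∈𝓕⁻ G∈
  ... | inj₁ refl                   | inj₁ refl                   = suc zero , thereᵥ hereᵥ
  ... | inj₁ refl                   | inj₂ (y , refl , _ , meets) =
    nonempty-∷ (subst Nonempty (∩-comm y _) (meetsFirst⇒nonempty meets))
  ... | inj₂ (x , refl , _ , meets) | inj₁ refl                   = nonempty-∷ (meetsFirst⇒nonempty meets)
  ... | inj₂ (x , refl , _ , _)     | inj₂ (y , refl , _ , _)     = zero , hereᵥ

  ─∈D : ∀ {F G} → F ∈ 𝓕 → G ∈ 𝓕 → F ─ G ∈ D 𝓕
  ─∈D {F} F∈ G∈ =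
    ∈-deduplicate⁺ (≡-dec _≟ᵇ_) (∈-concat⁺′ (∈-map⁺ (F ─_) G∈) (∈-map⁺ (λ F → map (F ─_) 𝓕) F∈))

  -- x = ({0} ∪ x ∪ F) ∖ ({0} ∪ F′), with F and F′ the first m − |x| and the first m points outside x
  outside∷x∈D : ∀ {x} → x ∈ lowOrMeeting N m k → outside ∷ x ∈ D 𝓕
  outside∷x∈D {x} x∈ = subst (_∈ D 𝓕) (cong (outside ∷_) (∪firstFree─firstFree x (m∸n≤m m ∣ x ∣)))
                                     (─∈D (∈𝓕⁺ (∣y∣≡m , meets-y)) (∈𝓕⁺ (∣z∣≡m , meets-z)))
    where
    ∣x∣≤m = proj₁ (∈-lowOrMeeting⁻ N m k x∈)
    t = m ∸ ∣ x ∣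
    y = x ∪ firstFree t x
    z = firstFree m x
    ∣x∣<k : ∣ x ∣ < k
    ∣x∣<k = s≤s ∣x∣≤m
    room : ∀ {t} → t ≤ m → t + ∣ x ∣ ≤ k + N
    room t≤m = ≤-trans (+-mono-≤ t≤m (≤-trans ∣x∣≤m m≤N)) (n≤1+n (m + N))
    ∣y∣≡m : ∣ y ∣ ≡ m
    ∣y∣≡m = begin
      ∣ y ∣                      ≡⟨ ∣∪firstFree∣ t x ⟩
      ∣ x ∣ + ∣ firstFree t x ∣  ≡⟨ cong (∣ x ∣ +_) (∣firstFree∣ t x (room (m∸n≤m m ∣ x ∣))) ⟩
      ∣ x ∣ + t                  ≡⟨ m+[n∸m]≡n ∣x∣≤m ⟩
      m                          ∎
      where open ≡-Reasoning
    meets-y : MeetsFirst k y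
    meets-y with proj₂ (∈-lowOrMeeting⁻ N m k x∈)
    ... | inj₁ meets = meetsFirst-∪ˡ (firstFree t x) meets
    ... | inj₂ ∣x∣<m = meetsFirst-∪ʳ x (meetsFirst-firstFree x (m<n⇒0<n∸m ∣x∣<m) ∣x∣<k)
    ∣z∣≡m : ∣ z ∣ ≡ m
    ∣z∣≡m = ∣firstFree∣ m x (room ≤-refl)
    meets-z : MeetsFirst k z
    meets-z = meetsFirst-firstFree x 0<m ∣x∣<k

  -- {0} ∪ W = ({0} ∪ E ∪ W) ∖ B for any nonempty E ⊆ B of size m − |W|
  inside∷⊥++w∈D : ∀ {w} → w ∈ subsetsBelow N m → inside ∷ (⊥ {k} ++ w) ∈ D 𝓕
  inside∷⊥++w∈D {w} w∈ = subst (_∈ D 𝓕) (cong (inside ∷_) ─block)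
                                       (─∈D (∈𝓕⁺ (∣e++w∣≡m , meetsFirst-++ e w 0<∣e∣)) (here refl))
    where
    ∣w∣<m = ∈-subsetsBelow⁻ w∈
    t = m ∸ ∣ w ∣
    e = firstFree t (⊥ {k})
    ∣e∣≡t : ∣ e ∣ ≡ t
    ∣e∣≡t = ∣firstFree∣ t ⊥ (subst (λ u → t + u ≤ k) (sym (∣⊥∣≡0 k))
              (≤-trans (≤-reflexive (+-identityʳ t)) (≤-trans (m∸n≤m m ∣ w ∣) (n≤1+n m))))
    0<∣e∣ : 0 < ∣ e ∣
    0<∣e∣ = subst (0 <_) (sym ∣e∣≡t) (m<n⇒0<n∸m ∣w∣<m)
    ∣e++w∣≡m : ∣ e ++ w ∣ ≡ m
    ∣e++w∣≡m = trans (∣++∣ e w) (trans (cong (_+ ∣ w ∣) ∣e∣≡t) (m∸n+n≡m (<⇒≤ ∣w∣<m)))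
    ─block : (e ++ w) ─ (⊤ {k} ++ ⊥ {N}) ≡ ⊥ ++ w
    ─block = trans (zipWith-++ _ e w ⊤ ⊥) (cong₂ _++_ (p─⊤≡⊥ e) (p─⊥≡p w))

  avoiding0 containing0 : List (Subset (k + N))
  avoiding0   = lowOrMeeting N m k
  containing0 = map (⊥ {k} ++_) (subsetsBelow N m)

  realized : List (Subset (suc (k + N)))
  realized = branch avoiding0 containing0

  realized⊆D : realized ⊆ D 𝓕
  realized⊆D {outside ∷ x} F∈ = outside∷x∈D (∈-branch⁻ˡ {xs = avoiding0} {ys = containing0} F∈)
  realized⊆D {inside ∷ y}  F∈ with ∈-map⁻ (⊥ {k} ++_) (∈-branch⁻ʳ {xs = avoiding0} {ys = containing0} F∈)
  ... | w , w∈ , refl = inside∷⊥++w∈D w∈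

  realized-unique : Unique realized
  realized-unique = branch-unique (lowOrMeeting-unique N m k)
                                  (Unique.map⁺ (++-injectiveʳ (⊥ {k}) ⊥) (subsetsBelow-unique N m))

  ∣D∣-bound : N C m < ∑[ ℓ < m ] (N C ℓ) → ∣D∣ 𝓕 > binomSum (suc (k + N)) k
  ∣D∣-bound C<∑ = begin-strict
    binomSum (suc (k + N)) k                       ≡⟨ sum-map-upTo ((k + N) C_) k ⟩
    ∑[ ℓ < k ] ((k + N) C ℓ)                       ≡⟨ length-lowOrMeeting N m k ⟨
    length avoiding0 + N C m                       <⟨ +-monoʳ-< (length avoiding0) C<∑ ⟩
    length avoiding0 + ∑[ ℓ < m ] (N C ℓ)          ≡⟨ cong (length avoiding0 +_) length-containing0 ⟨
    length avoiding0 + length containing0          ≡⟨ length-branch avoiding0 containing0 ⟨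
    length realized                                ≤⟨ Unique-⊆⇒length-≤ realized-unique realized⊆D ⟩
    ∣D∣ 𝓕                                          ∎
    where
    open ≤-Reasoning
    length-containing0 : length containing0 ≡ ∑[ ℓ < m ] (N C ℓ)
    length-containing0 = trans (length-map (⊥ {k} ++_) (subsetsBelow N m)) (length-subsetsBelow N m)

exists-family : ∀ N m → m ≤ N → N C m < ∑[ ℓ < m ] (N C ℓ) →
                Σ (Family (suc (suc m + N))) λ 𝓕 →
                  Uniform (suc m) 𝓕 × Intersecting 𝓕 × (∣D∣ 𝓕 > binomSum (suc (suc m + N)) (suc m))
exists-family N zero    _   ()
exists-family N (suc m) m≤N C<∑ = 𝓕 , uniform , intersecting , ∣D∣-bound C<∑
  where open Construction N (suc m) (s≤s z≤n) m≤N

-- c = p / q = 2 + r / q, and near ℓ = m the ratio (N − ℓ) / (ℓ + 1) is about r / q < b / a.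
-- J terms suffice by geometricSum-exceeds; K is large enough for the ratio bound to hold
-- all the way down to ℓ = m − J (ratio-condition).
module Parameters (p q : ℕ) (0<q : 0 < q) (2q<p : 2 * q < p) (p<4q : p < 4 * q) where

  a b J r K : ℕ
  a = suc q
  b = suc q + q
  J = 2 + q
  r = p ∸ 2 * q
  K = a * (q + r) * J + J

  p≡2q+r : p ≡ 2 * q + r
  p≡2q+r = sym (m+[n∸m]≡n (<⇒≤ 2q<p))

  ar<qb : a * r < q * b
  ar<qb = +-cancelʳ-≤ q _ _ (begin
    suc (a * r) + q     ≡⟨ shift q r ⟩
    a * suc r           ≤⟨ *-monoʳ-≤ a r<2q ⟩
    a * (2 * q)         ≡⟨ double q ⟩
    q * b + q           ∎)
    where
    open ≤-Reasoning
    shift : ∀ q r → suc (suc q * r) + q ≡ suc q * suc r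
    shift = solve-∀
    double : ∀ q → suc q * (2 * q) ≡ q * (suc q + q) + q
    double = solve-∀
    two+two : ∀ q → 4 * q ≡ 2 * q + 2 * q
    two+two = solve-∀
    r<2q : r < 2 * q
    r<2q = +-cancelˡ-< (2 * q) r (2 * q) (subst₂ _<_ p≡2q+r (two+two q) p<4q)

  excess : ∀ n k → n * q ≡ p * k → ∃ λ d → n ≡ 2 * k + d × d * q ≡ r * k
  excess n k nq≡pk = d , sym (m+[n∸m]≡n 2k≤n) , dq≡rk
    where
    2k≤n : 2 * k ≤ n
    2k≤n = *-cancelʳ-≤ (2 * k) n q {{>-nonZero 0<q}} (begin
      2 * k * q          ≡⟨ swap k q ⟩
      2 * q * k          ≤⟨ *-monoˡ-≤ k (m≤m+n (2 * q) r) ⟩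
      (2 * q + r) * k    ≡⟨ cong (_* k) p≡2q+r ⟨
      p * k              ≡⟨ nq≡pk ⟨
      n * q              ∎)
      where
      open ≤-Reasoning
      swap : ∀ k q → 2 * k * q ≡ 2 * q * k
      swap = solve-∀
    d = n ∸ 2 * k
    dq≡rk : d * q ≡ r * k
    dq≡rk = +-cancelˡ-≡ (2 * q * k) _ _ (begin
      2 * q * k + d * q    ≡⟨ collect q k d ⟩
      (2 * k + d) * q      ≡⟨ cong (_* q) (m+[n∸m]≡n 2k≤n) ⟩
      n * q                ≡⟨ nq≡pk ⟩
      p * k                ≡⟨ cong (_* k) p≡2q+r ⟩
      (2 * q + r) * k      ≡⟨ *-distribʳ-+ k (2 * q) r ⟩
      2 * q * k + r * k    ∎)
      where
      open ≡-Reasoning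
      collect : ∀ q k d → 2 * q * k + d * q ≡ (2 * k + d) * q
      collect = solve-∀

  ratio-condition : ∀ s d → d * q ≡ r * (suc s + J) → a * (q + r) * J ≤ s → a * (J + d) ≤ suc s * b
  ratio-condition s d dq≡ bound = *-cancelˡ-≤ q {{>-nonZero 0<q}} (begin
    q * (a * (J + d))                    ≡⟨ expand q a J d ⟩
    a * q * J + a * (d * q)              ≡⟨ cong (λ u → a * q * J + a * u) dq≡ ⟩
    a * q * J + a * (r * (suc s + J))    ≡⟨ regroup a q J r (suc s) ⟩
    a * (q + r) * J + suc s * (a * r)    ≤⟨ +-monoˡ-≤ (suc s * (a * r)) (≤-trans bound (n≤1+n s)) ⟩
    suc s + suc s * (a * r)              ≡⟨ *-suc (suc s) (a * r) ⟨
    suc s * suc (a * r)                  ≤⟨ *-monoʳ-≤ (suc s) ar<qb ⟩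
    suc s * (q * b)                      ≡⟨ swap (suc s) q b ⟩
    q * (suc s * b)                      ∎)
    where
    open ≤-Reasoning
    expand : ∀ q a J d → q * (a * (J + d)) ≡ a * q * J + a * (d * q)
    expand = solve-∀
    regroup : ∀ a q J r x → a * q * J + a * (r * (x + J)) ≡ a * (q + r) * J + x * (a * r)
    regroup = solve-∀
    swap : ∀ x q b → x * (q * b) ≡ q * (x * b)
    swap = solve-∀

  decompose : ∀ n k → n * q ≡ p * k → k > K →
              ∃ λ m → ∃ λ N → k ≡ suc m × n ≡ suc (suc m + N) × m ≤ N × N C m < ∑[ ℓ < m ] (N C ℓ)
  decompose n (suc m) nq≡pk (s≤s K≤m) with excess n (suc m) nq≡pk
  ... | d , n≡2k+d , dq≡rk = m , m + d , refl , trans n≡2k+d (shape m d) , m≤m+n m d , C<∑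
    where
    shape : ∀ m d → 2 * suc m + d ≡ suc (suc m + (m + d))
    shape = solve-∀
    s = m ∸ J
    m≡s+J : m ≡ s + J
    m≡s+J = sym (m∸n+n≡m (≤-trans (m≤n+m J _) K≤m))
    N∸s : m + d ∸ s ≡ J + d
    N∸s = trans (cong (λ u → u + d ∸ s) m≡s+J) (trans (cong (_∸ s) (+-assoc s J d)) (m+n∸m≡n s (J + d)))
    cond : a * (m + d ∸ s) ≤ suc s * b
    cond = subst (λ u → a * u ≤ suc s * b) (sym N∸s)
             (ratio-condition s d (trans dq≡rk (cong (λ u → r * suc u) m≡s+J))
                (+-cancelʳ-≤ J _ _ (subst (K ≤_) m≡s+J K≤m)))
    C<∑ : (m + d) C m < ∑[ ℓ < m ] ((m + d) C ℓ)
    C<∑ = subst (λ u → (m + d) C u < ∑[ ℓ < u ] ((m + d) C ℓ)) (sym m≡s+J)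
            (C<∑< (geometricSum-exceeds q 0<q) (subst (_≤ m + d) m≡s+J (m≤m+n m d)) cond)

theorem6 : (p q : ℕ) → q > 0 → 2 * q < p → p < 4 * q →
    ∃ λ (K : ℕ) → (n k : ℕ) → n * q ≡ p * k → k > K →
      Σ (Family n) λ 𝓕 → Uniform k 𝓕 × Intersecting 𝓕 × (∣D∣ 𝓕 > binomSum n k)
theorem6 p q 0<q 2q<p p<4q = K , family
  where
  open Parameters p q 0<q 2q<p p<4q
  family : ∀ n k → n * q ≡ p * k → k > K →
           Σ (Family n) λ 𝓕 → Uniform k 𝓕 × Intersecting 𝓕 × (∣D∣ 𝓕 > binomSum n k)
  family n k nq≡pk k>K with decompose n k nq≡pk k>K
  ... | m , N , refl , refl , m≤N , C<∑ = exists-family N m m≤N C<∑
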